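{- Let $J$ be a set of unit-time, unit-consumption jobs with acyclic precedence graph $G$, let $P$ be a critical path of $G$ and $m^*$ the size of a maximum matching in the independence graph $\widetilde{G}$. For any $M\in\mathbb{N}$ with $M\ge|P|$, the optimal objective value satisfies $F^*(M)\le M+m^*$.
   Context: Schedules are $x\in\mathbb{N}^J$, feasible if $x_i+1\le x_j$ for each arc $(i,j)$ of $G$ and $C_{max}(x)=\max_i(x_i+1)\le M$. With $r_\tau(x)=|\{i:x_i=\tau\}|$, $F(x)=\sum_{\tau=0}^{C_{max}(x)-1}\min(2,r_\tau(x))$ and $F^*(M)$ is the maximum of $F$ over feasible schedules for deadline $M$. A critical path is a path of $G$ with the maximum number of jobs. Two distinct jobs are independent if there is no directed path between them in $G$; $\widetilde{G}$ is the graph on $J$ whose edges are the independent pairs. -}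

module Defs where

open import Data.Nat using (ℕ; zero; suc; _+_; _≤_; _⊔_; _⊓_)
open import Data.Fin using (Fin)
open import Data.List using (List; []; _∷_; length; map; foldr; concatMap; allFin; upTo; filter)
open import Data.Nat.ListAction using (sum)
open import Data.List.Relation.Unary.Linked using (Linked)
open import Data.List.Relation.Unary.All using (All)
open import Data.List.Relation.Unary.Unique.Propositional using (Unique)
open import Data.Product using (_×_; _,_; Σ)
open import Relation.Nullary using (¬_)
open import Relation.Binary.PropositionalEquality using (_≡_; _≢_)
open import Relation.Binary.Construct.Closure.Transitive using (TransClosure)
import Data.Nat as ℕ

-- Jobs are Fin n; the precedence graph G is an arc relation E on Fin n.
Graph : ℕ → Set₁
Graph n = Fin n → Fin n → Set

Reach : ∀ {n} → Graph n → Fin n → Fin n → Set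
Reach E = TransClosure E

Acyclic : ∀ {n} → Graph n → Set
Acyclic E = ∀ i → ¬ Reach E i i

-- A path of G, given as its list of jobs (consecutive jobs joined by arcs);
-- its number of jobs is the length of the list.
IsPath : ∀ {n} → Graph n → List (Fin n) → Set
IsPath E P = Linked E P

IsCriticalPath : ∀ {n} → Graph n → List (Fin n) → Set
IsCriticalPath E P = IsPath E P × (∀ Q → IsPath E Q → length Q ≤ length P)

Independent : ∀ {n} → Graph n → Fin n → Fin n → Set
Independent E i j = i ≢ j × ¬ Reach E i j × ¬ Reach E j i

endpoints : ∀ {n} → List (Fin n × Fin n) → List (Fin n)
endpoints = concatMap (λ { (a , b) → a ∷ b ∷ [] })

IsMatching : ∀ {n} → Graph n → List (Fin n × Fin n) → Set
IsMatching E Mt = All (λ { (a , b) → Independent E a b }) Mt × Unique (endpoints Mt)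

IsMaxMatchingSize : ∀ {n} → Graph n → ℕ → Set
IsMaxMatchingSize E m =
  Σ (List (Fin _ × Fin _)) (λ Mt → IsMatching E Mt × length Mt ≡ m)
  × (∀ Mt → IsMatching E Mt → length Mt ≤ m)

Schedule : ℕ → Set
Schedule n = Fin n → ℕ

Cmax : ∀ {n} → Schedule n → ℕ
Cmax {n} x = foldr _⊔_ 0 (map (λ i → suc (x i)) (allFin n))

r : ∀ {n} → Schedule n → ℕ → ℕ
r {n} x τ = length (filter (λ i → x i ℕ.≟ τ) (allFin n))

F : ∀ {n} → Schedule n → ℕ
F x = sum (map (λ τ → 2 ⊓ r x τ) (upTo (Cmax x)))

Feasible : ∀ {n} → Graph n → ℕ → Schedule n → Set
Feasible E M x = (∀ i j → E i j → x i + 1 ≤ x j) × Cmax x ≤ M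

{-# OPTIONS --safe #-}
-- In a feasible schedule, two jobs started in the same slot cannot be joined by
-- a directed path, since start times strictly increase along paths. So every
-- slot holding at least two jobs contributes one pair of independent jobs, and
-- pairs from different slots are disjoint: they form a matching of the
-- independence graph. Each slot contributes at most 1 + (number of its pairs)
-- to F, and there are Cmax ≤ M slots, whence F ≤ M + m*.
module Submission where

open import Defs
open import Algebra.Properties.CommutativeSemigroup using (x∙yz≈y∙xz)
open import Data.Fin using (Fin)
open import Data.List using (List; []; _∷_; _++_; length; map; filter; allFin; upTo)
open import Data.List.Membership.Propositional using (_∈_)
open import Data.List.Properties using (concatMap-++; length-++; length-upTo)
open import Data.List.Relation.Binary.Disjoint.Propositional using (Disjoint)
open import Data.List.Relation.Unary.All as All using (All; []; _∷_)
import Data.List.Relation.Unary.All.Properties as All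
open import Data.List.Relation.Unary.AllPairs using ([]; _∷_)
open import Data.List.Relation.Unary.Any using (here; there)
open import Data.List.Relation.Unary.Unique.Propositional using (Unique)
import Data.List.Relation.Unary.Unique.Propositional.Properties as Unique
open import Data.Nat using (ℕ; suc; _+_; _≤_; _<_; _⊓_; _≟_; z≤n; s≤s)
open import Data.Nat.ListAction using (sum)
open import Data.Nat.Properties
open import Data.Product using (_×_; _,_)
open import Relation.Binary.Construct.Closure.Transitive using ([_]; _∷_)
open import Relation.Binary.PropositionalEquality

module _ {a} {A : Set a} where

  firstPair : List A → List (A × A)
  firstPair (u ∷ v ∷ _) = (u , v) ∷ []
  firstPair _           = []

  2⊓length≤1+length-firstPair : ∀ xs → 2 ⊓ length xs ≤ 1 + length (firstPair xs)
  2⊓length≤1+length-firstPair []          = z≤n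
  2⊓length≤1+length-firstPair (_ ∷ [])    = s≤s z≤n
  2⊓length≤1+length-firstPair (_ ∷ _ ∷ _) = ≤-refl

  firstPair-constant : ∀ {b} {B : Set b} (f : A → B) {c xs} →
                       All (λ u → f u ≡ c) xs → All (λ (u , v) → f u ≡ f v) (firstPair xs)
  firstPair-constant f {xs = []}        _              = []
  firstPair-constant f {xs = _ ∷ []}    _              = []
  firstPair-constant f {xs = _ ∷ _ ∷ _} (fu ∷ fv ∷ _) = trans fu (sym fv) ∷ []

module _ {n : ℕ} where

  All-endpoints-firstPair : ∀ {p} {P : Fin n → Set p} {xs : List (Fin n)} →
                            All P xs → All P (endpoints (firstPair xs))
  All-endpoints-firstPair {xs = []}        _              = []
  All-endpoints-firstPair {xs = _ ∷ []}    _              = []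
  All-endpoints-firstPair {xs = _ ∷ _ ∷ _} (pu ∷ pv ∷ _) = pu ∷ pv ∷ []

  Unique-endpoints-firstPair : ∀ {xs : List (Fin n)} → Unique xs → Unique (endpoints (firstPair xs))
  Unique-endpoints-firstPair {[]}        _                = []
  Unique-endpoints-firstPair {_ ∷ []}    _                = []
  Unique-endpoints-firstPair {_ ∷ _ ∷ _} ((u≢v ∷ _) ∷ _) = (u≢v ∷ []) ∷ [] ∷ []

  Unique-endpoints⇒distinct : (Mt : List (Fin n × Fin n)) → Unique (endpoints Mt) →
                              All (λ (u , v) → u ≢ v) Mt
  Unique-endpoints⇒distinct []       _                            = []
  Unique-endpoints⇒distinct (_ ∷ Mt) ((u≢v ∷ _) ∷ _ ∷ unique) =
    u≢v ∷ Unique-endpoints⇒distinct Mt unique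

  endpoints-++ : (Mt Mt′ : List (Fin n × Fin n)) →
                 endpoints (Mt ++ Mt′) ≡ endpoints Mt ++ endpoints Mt′
  endpoints-++ = concatMap-++ _

module _ {n : ℕ} (x : Schedule n) where

  startingAt : ℕ → List (Fin n)
  startingAt τ = filter (λ i → x i ≟ τ) (allFin n)

  startingAt-startsAt : ∀ τ → All (λ i → x i ≡ τ) (startingAt τ)
  startingAt-startsAt τ = All.all-filter (λ i → x i ≟ τ) (allFin n)

  Unique-startingAt : ∀ τ → Unique (startingAt τ)
  Unique-startingAt τ = Unique.filter⁺ (λ i → x i ≟ τ) (Unique.allFin⁺ n)

  sameSlotPairs : List ℕ → List (Fin n × Fin n)
  sameSlotPairs []      = []
  sameSlotPairs (τ ∷ L) = firstPair (startingAt τ) ++ sameSlotPairs L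

  sameSlotPairs-sameStart : ∀ L → All (λ (u , v) → x u ≡ x v) (sameSlotPairs L)
  sameSlotPairs-sameStart []      = []
  sameSlotPairs-sameStart (τ ∷ L) =
    All.++⁺ (firstPair-constant x (startingAt-startsAt τ)) (sameSlotPairs-sameStart L)

  sameSlotPairs-startsIn : ∀ L → All (λ i → x i ∈ L) (endpoints (sameSlotPairs L))
  sameSlotPairs-startsIn []      = []
  sameSlotPairs-startsIn (τ ∷ L) =
    subst (All (λ i → x i ∈ τ ∷ L)) (sym (endpoints-++ (firstPair (startingAt τ)) _))
      (All.++⁺ (All.map here (All-endpoints-firstPair (startingAt-startsAt τ)))
               (All.map there (sameSlotPairs-startsIn L)))

  Unique-endpoints-sameSlotPairs : ∀ {L} → Unique L → Unique (endpoints (sameSlotPairs L))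
  Unique-endpoints-sameSlotPairs {[]}    _           = []
  Unique-endpoints-sameSlotPairs {τ ∷ L} (τ∉L ∷ uL) =
    subst Unique (sym (endpoints-++ (firstPair (startingAt τ)) _))
      (Unique.++⁺ (Unique-endpoints-firstPair (Unique-startingAt τ))
                  (Unique-endpoints-sameSlotPairs uL)
                  slotsDisjoint)
    where
    slotsDisjoint : Disjoint (endpoints (firstPair (startingAt τ))) (endpoints (sameSlotPairs L))
    slotsDisjoint (i∈slot , i∈rest) =
      All.lookup τ∉L (All.lookup (sameSlotPairs-startsIn L) i∈rest)
        (sym (All.lookup (All-endpoints-firstPair (startingAt-startsAt τ)) i∈slot))

  sum-2⊓r≤length+length-sameSlotPairs :
    ∀ L → sum (map (λ τ → 2 ⊓ r x τ) L) ≤ length L + length (sameSlotPairs L)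
  sum-2⊓r≤length+length-sameSlotPairs []      = z≤n
  sum-2⊓r≤length+length-sameSlotPairs (τ ∷ L) = begin
    2 ⊓ r x τ + sum (map (λ τ → 2 ⊓ r x τ) L)
      ≤⟨ +-mono-≤ (2⊓length≤1+length-firstPair (startingAt τ))
                  (sum-2⊓r≤length+length-sameSlotPairs L) ⟩
    suc (length slot + (length L + length (sameSlotPairs L)))
      ≡⟨ cong suc (x∙yz≈y∙xz +-commutativeSemigroup (length slot) (length L) _) ⟩
    suc (length L + (length slot + length (sameSlotPairs L)))
      ≡⟨ cong (λ k → suc (length L + k)) (sym (length-++ slot)) ⟩
    length (τ ∷ L) + length (sameSlotPairs (τ ∷ L)) ∎
    where
    open ≤-Reasoning
    slot : List (Fin n × Fin n)
    slot = firstPair (startingAt τ)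

  F≤Cmax+length-sameSlotPairs : F x ≤ Cmax x + length (sameSlotPairs (upTo (Cmax x)))
  F≤Cmax+length-sameSlotPairs =
    subst (λ k → F x ≤ k + length (sameSlotPairs (upTo (Cmax x))))
      (length-upTo (Cmax x))
      (sum-2⊓r≤length+length-sameSlotPairs (upTo (Cmax x)))

module _ {n : ℕ} (E : Graph n) {x : Schedule n} (precedence : ∀ i j → E i j → x i + 1 ≤ x j) where

  arc⇒< : ∀ {i j} → E i j → x i < x j
  arc⇒< {i} {j} e = subst (_≤ x j) (+-comm (x i) 1) (precedence i j e)

  Reach⇒< : ∀ {i j} → Reach E i j → x i < x j
  Reach⇒< [ e ]   = arc⇒< e
  Reach⇒< (e ∷ p) = <-trans (arc⇒< e) (Reach⇒< p)

  sameStart⇒Independent : ∀ {i j} → x i ≡ x j → i ≢ j → Independent E i j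
  sameStart⇒Independent xi≡xj i≢j =
    i≢j , (λ p → <-irrefl xi≡xj (Reach⇒< p)) , (λ p → <-irrefl (sym xi≡xj) (Reach⇒< p))

  sameSlotPairs-isMatching : ∀ {L} → Unique L → IsMatching E (sameSlotPairs x L)
  sameSlotPairs-isMatching {L} uL =
    All.zipWith (λ (sameStart , distinct) → sameStart⇒Independent sameStart distinct)
      (sameSlotPairs-sameStart x L , Unique-endpoints⇒distinct _ unique)
    , unique
    where
    unique : Unique (endpoints (sameSlotPairs x L))
    unique = Unique-endpoints-sameSlotPairs x uL

lemma5 : ∀ {n} (E : Graph n) → Acyclic E →
           (P : List (Fin n)) → IsCriticalPath E P →
           (mstar : ℕ) → IsMaxMatchingSize E mstar →
           (M : ℕ) → length P ≤ M →
           ∀ (x : Schedule n) → Feasible E M x → F x ≤ M + mstar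
lemma5 E _ _ _ mstar (_ , maximum) M _ x (precedence , Cmax≤M) = begin
  F x                                               ≤⟨ F≤Cmax+length-sameSlotPairs x ⟩
  Cmax x + length (sameSlotPairs x (upTo (Cmax x))) ≤⟨ +-mono-≤ Cmax≤M (maximum _ isMatching) ⟩
  M + mstar                                         ∎
  where
  open ≤-Reasoning
  isMatching : IsMatching E (sameSlotPairs x (upTo (Cmax x)))
  isMatching = sameSlotPairs-isMatching E precedence (Unique.upTo⁺ (Cmax x))
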